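{- For every rational number $t$, define $$a=16t^2(t^4-9)(t^4-2t^2+9),\quad b=(t^4-10t^2+9)(t^8+46t^4+81),\quad c=4t(t^2-3)(t^4-10t^2+9)(t^4+2t^2+9),$$ $$d_{ac}=4t(t^2-3)(t^8+46t^4+81),\quad d_{bc}=(t^4-2t^2+9)(t^8-82t^4+81),\quad d_s=(t^4-2t^2+9)(t^8+46t^4+81).$$ Then $a^2+c^2=d_{ac}^2$, $b^2+c^2=d_{bc}^2$ and $a^2+b^2+c^2=d_s^2$. Thus these give a nearly-perfect cuboid with edges $a,b,c$ in which all edges, the face diagonals $d_{ac},d_{bc}$ and the space diagonal $d_s$ are rational (only $d_{ab}=\sqrt{a^2+b^2}$ is not guaranteed rational).
   Context: This is the paper's "II parametrization" of nearly-perfect cuboids: cuboids with edges $a,b,c$ where among $a,b,c$, $d_{ab}=\sqrt{a^2+b^2}$, $d_{bc}=\sqrt{b^2+c^2}$, $d_{ac}=\sqrt{a^2+c^2}$, $d_s=\sqrt{a^2+b^2+c^2}$ only the face diagonal $d_{ab}$ may be irrational. -}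

module Defs where

open import Data.Nat using (ℕ; zero; suc)
open import Data.Integer using (+_)
open import Data.Rational using (ℚ; _+_; _-_; _*_; 1ℚ; _/_)

infixr 8 _^_
_^_ : ℚ → ℕ → ℚ
x ^ zero  = 1ℚ
x ^ suc n = x * (x ^ n)

[_] : ℕ → ℚ
[ n ] = + n / 1

edgeA edgeB edgeC dAC dBC dS : ℚ → ℚ
edgeA t = [ 16 ] * t ^ 2 * (t ^ 4 - [ 9 ]) * (t ^ 4 - [ 2 ] * t ^ 2 + [ 9 ])
edgeB t = (t ^ 4 - [ 10 ] * t ^ 2 + [ 9 ]) * (t ^ 8 + [ 46 ] * t ^ 4 + [ 81 ])
edgeC t = [ 4 ] * t * (t ^ 2 - [ 3 ]) * (t ^ 4 - [ 10 ] * t ^ 2 + [ 9 ]) * (t ^ 4 + [ 2 ] * t ^ 2 + [ 9 ])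
dAC   t = [ 4 ] * t * (t ^ 2 - [ 3 ]) * (t ^ 8 + [ 46 ] * t ^ 4 + [ 81 ])
dBC   t = (t ^ 4 - [ 2 ] * t ^ 2 + [ 9 ]) * (t ^ 8 - [ 82 ] * t ^ 4 + [ 81 ])
dS    t = (t ^ 4 - [ 2 ] * t ^ 2 + [ 9 ]) * (t ^ 8 + [ 46 ] * t ^ 4 + [ 81 ])

-- Each of the three identities splits off a Pythagorean triple given by Euclid's formula
-- (m² − n², 2mn, m² + n²), scaled by a common factor k:
--   (c, a, d_ac)   with m = t⁴ − 2t² + 9, n = 2t(t² + 3), k = 4t(t² − 3);
--   (b, d_ac, d_s) with m = t² − 3,       n = 2t,          k = t⁸ + 46t⁴ + 81;
--   (d_bc, a, d_s) with m = t⁴ − 9,       n = 8t²,         k = t⁴ − 2t² + 9.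
-- The first two give a² + b² + c² = d_ac² + b² = d_s², and comparing with the third
-- gives b² + c² = d_s² − a² = d_bc².
module Submission where

open import Defs
open import Data.Nat using (ℕ)
open import Data.Rational using (ℚ; _+_; _-_; _*_)
open import Data.Rational.Properties using (+-assoc; +-comm; +-0-group)
open import Data.Rational.Solver using (module +-*-Solver)
open import Data.Product using (_×_; _,_)
open import Relation.Binary.PropositionalEquality using (_≡_; refl; sym; trans; cong; module ≡-Reasoning)
open import Algebra.Properties.Group +-0-group using (∙-cancelˡ)

open +-*-Solver

⟨_⟩ : ∀ {d} → ℕ → Polynomial d
⟨ n ⟩ = con [ n ]

IsPythagorean : ℚ → ℚ → ℚ → Set
IsPythagorean x y z = x ^ 2 + y ^ 2 ≡ z ^ 2

isPythagorean-comm : ∀ x y z → IsPythagorean x y z → IsPythagorean y x z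
isPythagorean-comm x y z p = trans (+-comm (y ^ 2) (x ^ 2)) p

isPythagorean-scale : ∀ k {x y z} → IsPythagorean x y z → IsPythagorean (k * x) (k * y) (k * z)
isPythagorean-scale k {x} {y} {z} p = begin
  (k * x) ^ 2 + (k * y) ^ 2 ≡⟨ solve 3 (λ k x y → (k :* x) :^ 2 :+ (k :* y) :^ 2
                                              := k :^ 2 :* (x :^ 2 :+ y :^ 2)) refl k x y ⟩
  k ^ 2 * (x ^ 2 + y ^ 2)   ≡⟨ cong (k ^ 2 *_) p ⟩
  k ^ 2 * z ^ 2             ≡⟨ solve 2 (λ k z → k :^ 2 :* z :^ 2 := (k :* z) :^ 2) refl k z ⟩
  (k * z) ^ 2               ∎
  where open ≡-Reasoning

euclid-isPythagorean : ∀ m n → IsPythagorean (m ^ 2 - n ^ 2) ([ 2 ] * m * n) (m ^ 2 + n ^ 2)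
euclid-isPythagorean = solve 2 (λ m n →
  (m :^ 2 :- n :^ 2) :^ 2 :+ (⟨ 2 ⟩ :* m :* n) :^ 2 := (m :^ 2 :+ n :^ 2) :^ 2) refl

scaledEuclid-isPythagorean : ∀ k m n {x y z} →
  k * (m ^ 2 - n ^ 2) ≡ x → k * ([ 2 ] * m * n) ≡ y → k * (m ^ 2 + n ^ 2) ≡ z →
  IsPythagorean x y z
scaledEuclid-isPythagorean k m n refl refl refl = isPythagorean-scale k (euclid-isPythagorean m n)

spaceDiagonal : ∀ a b c d e → IsPythagorean a c d → IsPythagorean b d e →
                a ^ 2 + b ^ 2 + c ^ 2 ≡ e ^ 2
spaceDiagonal a b c d e acd bde = begin
  a ^ 2 + b ^ 2 + c ^ 2   ≡⟨ solve 3 (λ a b c → a :^ 2 :+ b :^ 2 :+ c :^ 2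
                                            := b :^ 2 :+ (a :^ 2 :+ c :^ 2)) refl a b c ⟩
  b ^ 2 + (a ^ 2 + c ^ 2) ≡⟨ cong (b ^ 2 +_) acd ⟩
  b ^ 2 + d ^ 2           ≡⟨ bde ⟩
  e ^ 2                   ∎
  where open ≡-Reasoning

faceDiagonal : ∀ a b c e f → a ^ 2 + b ^ 2 + c ^ 2 ≡ e ^ 2 → IsPythagorean f a e →
               IsPythagorean b c f
faceDiagonal a b c e f abce fae = ∙-cancelˡ (a ^ 2) (b ^ 2 + c ^ 2) (f ^ 2) (begin
  a ^ 2 + (b ^ 2 + c ^ 2) ≡⟨ sym (+-assoc (a ^ 2) (b ^ 2) (c ^ 2)) ⟩
  a ^ 2 + b ^ 2 + c ^ 2   ≡⟨ abce ⟩
  e ^ 2                   ≡⟨ sym fae ⟩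
  f ^ 2 + a ^ 2           ≡⟨ +-comm (f ^ 2) (a ^ 2) ⟩
  a ^ 2 + f ^ 2           ∎)
  where open ≡-Reasoning

module Parametrization {d} (t : Polynomial d) where
  a b c dac dbc ds : Polynomial d
  a   = ⟨ 16 ⟩ :* t :^ 2 :* (t :^ 4 :- ⟨ 9 ⟩) :* (t :^ 4 :- ⟨ 2 ⟩ :* t :^ 2 :+ ⟨ 9 ⟩)
  b   = (t :^ 4 :- ⟨ 10 ⟩ :* t :^ 2 :+ ⟨ 9 ⟩) :* (t :^ 8 :+ ⟨ 46 ⟩ :* t :^ 4 :+ ⟨ 81 ⟩)
  c   = ⟨ 4 ⟩ :* t :* (t :^ 2 :- ⟨ 3 ⟩) :* (t :^ 4 :- ⟨ 10 ⟩ :* t :^ 2 :+ ⟨ 9 ⟩) :* (t :^ 4 :+ ⟨ 2 ⟩ :* t :^ 2 :+ ⟨ 9 ⟩)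
  dac = ⟨ 4 ⟩ :* t :* (t :^ 2 :- ⟨ 3 ⟩) :* (t :^ 8 :+ ⟨ 46 ⟩ :* t :^ 4 :+ ⟨ 81 ⟩)
  dbc = (t :^ 4 :- ⟨ 2 ⟩ :* t :^ 2 :+ ⟨ 9 ⟩) :* (t :^ 8 :- ⟨ 82 ⟩ :* t :^ 4 :+ ⟨ 81 ⟩)
  ds  = (t :^ 4 :- ⟨ 2 ⟩ :* t :^ 2 :+ ⟨ 9 ⟩) :* (t :^ 8 :+ ⟨ 46 ⟩ :* t :^ 4 :+ ⟨ 81 ⟩)

open Parametrization

c-a-dAC-isPythagorean : ∀ t → IsPythagorean (edgeC t) (edgeA t) (dAC t)
c-a-dAC-isPythagorean t = scaledEuclid-isPythagorean
  ([ 4 ] * t * (t ^ 2 - [ 3 ])) (t ^ 4 - [ 2 ] * t ^ 2 + [ 9 ]) ([ 2 ] * t * (t ^ 2 + [ 3 ]))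
  (solve 1 (λ t → k t :* (m t :^ 2 :- n t :^ 2) := c t) refl t)
  (solve 1 (λ t → k t :* (⟨ 2 ⟩ :* m t :* n t) := a t) refl t)
  (solve 1 (λ t → k t :* (m t :^ 2 :+ n t :^ 2) := dac t) refl t)
  where
  k m n : ∀ {d} → Polynomial d → Polynomial d
  k t = ⟨ 4 ⟩ :* t :* (t :^ 2 :- ⟨ 3 ⟩)
  m t = t :^ 4 :- ⟨ 2 ⟩ :* t :^ 2 :+ ⟨ 9 ⟩
  n t = ⟨ 2 ⟩ :* t :* (t :^ 2 :+ ⟨ 3 ⟩)

b-dAC-dS-isPythagorean : ∀ t → IsPythagorean (edgeB t) (dAC t) (dS t)
b-dAC-dS-isPythagorean t = scaledEuclid-isPythagorean
  (t ^ 8 + [ 46 ] * t ^ 4 + [ 81 ]) (t ^ 2 - [ 3 ]) ([ 2 ] * t)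
  (solve 1 (λ t → k t :* (m t :^ 2 :- n t :^ 2) := b t) refl t)
  (solve 1 (λ t → k t :* (⟨ 2 ⟩ :* m t :* n t) := dac t) refl t)
  (solve 1 (λ t → k t :* (m t :^ 2 :+ n t :^ 2) := ds t) refl t)
  where
  k m n : ∀ {d} → Polynomial d → Polynomial d
  k t = t :^ 8 :+ ⟨ 46 ⟩ :* t :^ 4 :+ ⟨ 81 ⟩
  m t = t :^ 2 :- ⟨ 3 ⟩
  n t = ⟨ 2 ⟩ :* t

dBC-a-dS-isPythagorean : ∀ t → IsPythagorean (dBC t) (edgeA t) (dS t)
dBC-a-dS-isPythagorean t = scaledEuclid-isPythagorean
  (t ^ 4 - [ 2 ] * t ^ 2 + [ 9 ]) (t ^ 4 - [ 9 ]) ([ 8 ] * t ^ 2)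
  (solve 1 (λ t → k t :* (m t :^ 2 :- n t :^ 2) := dbc t) refl t)
  (solve 1 (λ t → k t :* (⟨ 2 ⟩ :* m t :* n t) := a t) refl t)
  (solve 1 (λ t → k t :* (m t :^ 2 :+ n t :^ 2) := ds t) refl t)
  where
  k m n : ∀ {d} → Polynomial d → Polynomial d
  k t = t :^ 4 :- ⟨ 2 ⟩ :* t :^ 2 :+ ⟨ 9 ⟩
  m t = t :^ 4 :- ⟨ 9 ⟩
  n t = ⟨ 8 ⟩ :* t :^ 2

mainTheorem4 : (t : ℚ) →
    (edgeA t ^ 2 + edgeC t ^ 2 ≡ dAC t ^ 2)
    × (edgeB t ^ 2 + edgeC t ^ 2 ≡ dBC t ^ 2)
    × (edgeA t ^ 2 + edgeB t ^ 2 + edgeC t ^ 2 ≡ dS t ^ 2)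
mainTheorem4 t = faceAC , faceBC , space
  where
  faceAC : IsPythagorean (edgeA t) (edgeC t) (dAC t)
  faceAC = isPythagorean-comm (edgeC t) (edgeA t) (dAC t) (c-a-dAC-isPythagorean t)

  space : edgeA t ^ 2 + edgeB t ^ 2 + edgeC t ^ 2 ≡ dS t ^ 2
  space = spaceDiagonal (edgeA t) (edgeB t) (edgeC t) (dAC t) (dS t) faceAC (b-dAC-dS-isPythagorean t)

  faceBC : IsPythagorean (edgeB t) (edgeC t) (dBC t)
  faceBC = faceDiagonal (edgeA t) (edgeB t) (edgeC t) (dS t) (dBC t) space (dBC-a-dS-isPythagorean t)
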